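{- For every $\epsilon>0$ and every natural number $n$ there is $N$ such that the following holds. For every function $f:Q_N\to[0,1]$ there is a set $S\subset[N]$ with $|S|=n$ such that for all $T_1,T_2\subseteq S$ with $|T_1|=|T_2|\ge1$ and all $1\le i\le|T_1|$, $$|f(t_{i,1},T_1)-f(t_{i,2},T_2)|\le\epsilon,$$ where $t_{i,m}$ denotes the $i$-th largest element of $T_m$.
   Context: $[N]=\{1,\dots,N\}$ and $Q_N=\{(t,T): t\in T\subseteq[N]\}$.
   Formalization: The parameter ε is a positive rational, and f takes values in the rationals of $[0,1]$ rather than in the whole real interval $[0,1]$. -}

module Defs where

open import Data.Nat using (ℕ; suc; _≤_)
open import Data.Fin using (Fin; _<?_)
open import Data.Fin.Subset using (Subset; _∈_; _∩_; ∣_∣)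
open import Data.Vec using (tabulate)
open import Data.Product using (_×_)
open import Relation.Nullary.Decidable using (⌊_⌋)
open import Relation.Binary.PropositionalEquality using (_≡_)

-- [N] is modelled by Fin N (with the order of Fin, i.e. k ↦ k+1).
-- Subsets of [N] are Data.Fin.Subset.Subset N.

StrictlyAbove : {N : ℕ} → Fin N → Subset N
StrictlyAbove t = tabulate (λ s → ⌊ t <? s ⌋)

IsIthLargest : {N : ℕ} → Subset N → ℕ → Fin N → Set
IsIthLargest T i t = (t ∈ T) × (suc ∣ T ∩ StrictlyAbove t ∣ ≡ i)

{-# OPTIONS --safe #-}
module Submission where

-- Choose K with K·ε ≥ 1 and colour each T ⊆ [N] by the bits "f(t, T) ≥ m·ε", where t is
-- the i-th largest element of T, i ≤ n and m ≤ K.  Two values in [0,1] with the same bits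
-- differ by at most ε, so it suffices to find an n-set S whose subsets of equal size all
-- get the same colour: Ramsey's theorem for all uniformities at once.  Take the least remaining candidate a and, halving once per
-- (subset U of the elements chosen so far, colour bit), keep only candidates y with
-- χ (U ∪ {a}) = χ (U ∪ {y}); this yields an end-homogeneous set E, on which the colour of
-- U ∪ {x} with U below x does not depend on x.  Removing max E and recursing on the
-- colouring U ↦ χ (U ∪ {max E}) gives the homogeneous set.

open import Data.List using (List)

module Subsets where

  open import Data.Bool using (Bool; true; false; T)
  open import Data.Bool.Properties using (T-≡; ∨-identityʳ)
  import Data.Bool as Bool
  open import Data.Fin as Fin using (Fin; zero; suc)
  open import Data.Fin.Subset
  open import Data.Fin.Subset.Properties
  open import Data.List using ([]; _∷_; [_]; length; map; _++_; cartesianProduct)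
  open import Data.List.Membership.Propositional using () renaming (_∈_ to _∈ₗ_)
  open import Data.List.Membership.Propositional.Properties using (∈-map⁺; ∈-++⁺ˡ; ∈-++⁺ʳ)
  open import Data.List.Properties using (length-map; length-++)
  open import Data.List.Relation.Unary.Any using (here; there)
  open import Data.Nat using (ℕ; zero; suc; _+_; _*_; _^_; _≤_; z≤n; s≤s)
  open import Data.Nat.Properties
    using (+-suc; +-comm; +-identityʳ; *-assoc; *-identityˡ; *-monoʳ-≤; +-monoˡ-≤; ≤-total; ≤-trans; ≤-reflexive)
  open import Data.Product as Product using (∃; _×_; _,_; proj₂)
  open import Data.Sum using (_⊎_; inj₁; inj₂)
  open import Data.Vec using (_∷_; []; tabulate; here; there)
  open import Data.Vec.Properties using (lookup∘tabulate; []=⇒lookup; lookup⇒[]=)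
  open import Function using (_∘_; id)
  open import Function.Bundles using (Equivalence)
  open import Relation.Nullary using (contradiction; yes; no)
  open import Relation.Nullary.Decidable using (⌊_⌋; toWitness)
  open import Relation.Binary.PropositionalEquality hiding ([_])

  private
    variable
      n : ℕ
      p q : Subset n
      x y : Fin n

  ∈-tabulate⁻ : ∀ {f : Fin n → Bool} → x ∈ tabulate f → T (f x)
  ∈-tabulate⁻ {x = x} {f} x∈ = Equivalence.from T-≡ (trans (sym (lookup∘tabulate f x)) ([]=⇒lookup x∈))

  ∈-tabulate⁺ : ∀ {f : Fin n → Bool} → T (f x) → x ∈ tabulate f
  ∈-tabulate⁺ {x = x} {f} t = lookup⇒[]= x _ (trans (lookup∘tabulate f x) (Equivalence.to T-≡ t))

  ∣p∣≡0⇒p≡⊥ : ∣ p ∣ ≡ 0 → p ≡ ⊥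
  ∣p∣≡0⇒p≡⊥ {p = []}          _ = refl
  ∣p∣≡0⇒p≡⊥ {p = outside ∷ p} e = cong (outside ∷_) (∣p∣≡0⇒p≡⊥ e)

  1≤∣p∣⇒Nonempty : 1 ≤ ∣ p ∣ → Nonempty p
  1≤∣p∣⇒Nonempty {p = inside  ∷ p} _ = zero , here
  1≤∣p∣⇒Nonempty {p = outside ∷ p} h = Product.map suc there (1≤∣p∣⇒Nonempty h)

  x∉p-x : x ∉ p - x
  x∉p-x {x = zero}  {p = _ ∷ p} ()
  x∉p-x {x = suc x} {p = _ ∷ p} (there x∈p-x) = x∉p-x x∈p-x

  x∈p-y⇒x≢y : x ∈ p - y → x ≢ y
  x∈p-y⇒x≢y x∈p-y refl = x∉p-x x∈p-y

  x∈p∪⁅y⁆⁻ : x ∈ p ∪ ⁅ y ⁆ → x ∈ p ⊎ x ≡ y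
  x∈p∪⁅y⁆⁻ {p = p} {y} x∈ with x∈p∪q⁻ p ⁅ y ⁆ x∈
  ... | inj₁ x∈p  = inj₁ x∈p
  ... | inj₂ x∈⁅y⁆ = inj₂ (x∈⁅y⁆⇒x≡y y x∈⁅y⁆)

  x∉p⇒∣p∪⁅x⁆∣≡1+∣p∣ : x ∉ p → ∣ p ∪ ⁅ x ⁆ ∣ ≡ suc ∣ p ∣
  x∉p⇒∣p∪⁅x⁆∣≡1+∣p∣ {x = zero}  {p = inside  ∷ p} x∉p = contradiction here x∉p
  x∉p⇒∣p∪⁅x⁆∣≡1+∣p∣ {x = zero}  {p = outside ∷ p} _   = cong (suc ∘ ∣_∣) (∪-identityʳ p)
  x∉p⇒∣p∪⁅x⁆∣≡1+∣p∣ {x = suc x} {p = inside  ∷ p} x∉p = cong suc (x∉p⇒∣p∪⁅x⁆∣≡1+∣p∣ (x∉p ∘ there))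
  x∉p⇒∣p∪⁅x⁆∣≡1+∣p∣ {x = suc x} {p = outside ∷ p} x∉p = x∉p⇒∣p∪⁅x⁆∣≡1+∣p∣ (x∉p ∘ there)

  x∈p⇒p-x∪⁅x⁆≡p : x ∈ p → (p - x) ∪ ⁅ x ⁆ ≡ p
  x∈p⇒p-x∪⁅x⁆≡p {x = zero}  {p = inside ∷ p} here = cong (inside ∷_) (trans (∪-identityʳ (p ─ ⊥)) (p─⊥≡p p))
  x∈p⇒p-x∪⁅x⁆≡p {x = suc x} {p = s ∷ p} (there x∈p) = cong₂ _∷_ (∨-identityʳ s) (x∈p⇒p-x∪⁅x⁆≡p x∈p)

  x∈p⇒∣p∣≡1+∣p-x∣ : x ∈ p → ∣ p ∣ ≡ suc ∣ p - x ∣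
  x∈p⇒∣p∣≡1+∣p-x∣ {x = x} {p = p} x∈p = begin
    ∣ p ∣                ≡⟨ cong ∣_∣ (x∈p⇒p-x∪⁅x⁆≡p x∈p) ⟨
    ∣ (p - x) ∪ ⁅ x ⁆ ∣  ≡⟨ x∉p⇒∣p∪⁅x⁆∣≡1+∣p∣ (x∉p-x {p = p}) ⟩
    suc ∣ p - x ∣        ∎
    where open ≡-Reasoning

  ∪-lub : ∀ {r} → p ⊆ r → q ⊆ r → p ∪ q ⊆ r
  ∪-lub {p = p} {q} p⊆r q⊆r x∈p∪q with x∈p∪q⁻ p q x∈p∪q
  ... | inj₁ x∈p = p⊆r x∈p
  ... | inj₂ x∈q = q⊆r x∈q

  x∈p⇒⁅x⁆⊆p : x ∈ p → ⁅ x ⁆ ⊆ p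
  x∈p⇒⁅x⁆⊆p {x = x} x∈p y∈⁅x⁆ = subst (_∈ _) (sym (x∈⁅y⁆⇒x≡y x y∈⁅x⁆)) x∈p

  x∈q∧p⊆q-x⇒p∪⁅x⁆⊆q : ∀ {q} → x ∈ q → p ⊆ q - x → p ∪ ⁅ x ⁆ ⊆ q
  x∈q∧p⊆q-x⇒p∪⁅x⁆⊆q {x = x} {q = q} x∈q p⊆q-x = ∪-lub (p─q⊆p q ⁅ x ⁆ ∘ p⊆q-x) (x∈p⇒⁅x⁆⊆p x∈q)

  minimum : Nonempty p → ∃ λ x → x ∈ p × (∀ {y} → y ∈ p → x Fin.≤ y)
  minimum {p = inside  ∷ p} _ = zero , here , λ _ → z≤n
  minimum {p = outside ∷ p} (suc x , there x∈p) with minimum (x , x∈p)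
  ... | m , m∈p , m≤ = suc m , there m∈p , λ { (there y∈p) → s≤s (m≤ y∈p) }

  maximum : Nonempty p → ∃ λ x → x ∈ p × (∀ {y} → y ∈ p → y Fin.≤ x)
  maximum {p = s ∷ p} ne with nonempty? p
  ... | yes ne′ with maximum ne′
  ...   | m , m∈p , ≤m = suc m , there m∈p , λ { here → z≤n ; (there y∈p) → s≤s (≤m y∈p) }
  maximum {p = s ∷ p} (zero , here) | no ¬ne =
    zero , here , λ { here → z≤n ; (there y∈p) → contradiction (_ , y∈p) ¬ne }
  maximum {p = s ∷ p} (suc x , there x∈p) | no ¬ne = contradiction (x , x∈p) ¬ne

  fibre : (Fin n → Bool) → Bool → Subset n
  fibre g b = tabulate (λ x → ⌊ g x Bool.≟ b ⌋)

  ∈-fibre⁻ : ∀ {g : Fin n → Bool} {b} → x ∈ fibre g b → g x ≡ b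
  ∈-fibre⁻ x∈ = toWitness (∈-tabulate⁻ x∈)

  ∣p∣≡∣p∩fibre-true∣+∣p∩fibre-false∣ : ∀ (g : Fin n → Bool) p →
    ∣ p ∣ ≡ ∣ p ∩ fibre g true ∣ + ∣ p ∩ fibre g false ∣
  ∣p∣≡∣p∩fibre-true∣+∣p∩fibre-false∣ g [] = refl
  ∣p∣≡∣p∩fibre-true∣+∣p∩fibre-false∣ g (s ∷ p) with s | g zero | ∣p∣≡∣p∩fibre-true∣+∣p∩fibre-false∣ (g ∘ suc) p
  ... | outside | _     | ih = ih
  ... | inside  | true  | ih = cong suc ih
  ... | inside  | false | ih = trans (cong suc ih) (sym (+-suc _ _))

  m≤n⇒m+n≤2*n : ∀ {m n} → m ≤ n → m + n ≤ 2 * n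
  m≤n⇒m+n≤2*n {n = n} m≤n = ≤-trans (+-monoˡ-≤ n m≤n) (≤-reflexive (cong (n +_) (sym (+-identityʳ n))))

  pigeonhole-fibre : ∀ (g : Fin n → Bool) p → ∃ λ b → ∣ p ∣ ≤ 2 * ∣ p ∩ fibre g b ∣
  pigeonhole-fibre g p
    with ∣p∣≡∣p∩fibre-true∣+∣p∩fibre-false∣ g p | ≤-total ∣ p ∩ fibre g true ∣ ∣ p ∩ fibre g false ∣
  ... | split | inj₁ t≤f = false , ≤-trans (≤-reflexive split) (m≤n⇒m+n≤2*n t≤f)
  ... | split | inj₂ f≤t =
    true , ≤-trans (≤-reflexive (trans split (+-comm ∣ p ∩ fibre g true ∣ _))) (m≤n⇒m+n≤2*n f≤t)

  ConstantOn : (Fin n → Bool) → Subset n → Set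
  ConstantOn g p = ∀ {x y} → x ∈ p → y ∈ p → g x ≡ g y

  uniformise : ∀ {K : Set} (g : K → Fin n → Bool) (ks : List K) (p : Subset n) →
    ∃ λ q → q ⊆ p × ∣ p ∣ ≤ 2 ^ length ks * ∣ q ∣ × (∀ {k} → k ∈ₗ ks → ConstantOn (g k) q)
  uniformise g []       p = p , id , ≤-reflexive (sym (*-identityˡ ∣ p ∣)) , λ ()
  uniformise g (k ∷ ks) p with pigeonhole-fibre (g k) p
  ... | b , ∣p∣≤ with uniformise g ks (p ∩ fibre (g k) b)
  ...   | q , q⊆ , ∣p∩fibre∣≤ , constant = q , p∩q⊆p p _ ∘ q⊆ , bound , constant′
    where
    bound : ∣ p ∣ ≤ 2 ^ suc (length ks) * ∣ q ∣
    bound = ≤-trans ∣p∣≤ (≤-trans (*-monoʳ-≤ 2 ∣p∩fibre∣≤) (≤-reflexive (sym (*-assoc 2 (2 ^ length ks) ∣ q ∣))))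
    constant′ : ∀ {k′} → k′ ∈ₗ k ∷ ks → ConstantOn (g k′) q
    constant′ (here refl)   x∈q y∈q =
      trans (∈-fibre⁻ (proj₂ (x∈p∩q⁻ p _ (q⊆ x∈q)))) (sym (∈-fibre⁻ (proj₂ (x∈p∩q⁻ p _ (q⊆ y∈q)))))
    constant′ (there k′∈ks) = constant k′∈ks

  subsets : Subset n → List (Subset n)
  subsets []            = [ [] ]
  subsets (inside  ∷ p) = map (inside ∷_) (subsets p) ++ map (outside ∷_) (subsets p)
  subsets (outside ∷ p) = map (outside ∷_) (subsets p)

  length-subsets : ∀ (p : Subset n) → length (subsets p) ≡ 2 ^ ∣ p ∣
  length-subsets []            = refl
  length-subsets (inside  ∷ p) = begin
    length (map (inside ∷_) (subsets p) ++ map (outside ∷_) (subsets p))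
      ≡⟨ length-++ (map (inside ∷_) (subsets p)) ⟩
    length (map (inside ∷_) (subsets p)) + length (map (outside ∷_) (subsets p))
      ≡⟨ cong₂ _+_ (length-map (inside ∷_) (subsets p)) (length-map (outside ∷_) (subsets p)) ⟩
    length (subsets p) + length (subsets p)  ≡⟨ cong₂ _+_ (length-subsets p) (length-subsets p) ⟩
    2 ^ ∣ p ∣ + 2 ^ ∣ p ∣                    ≡⟨ cong (2 ^ ∣ p ∣ +_) (+-identityʳ _) ⟨
    2 * 2 ^ ∣ p ∣                            ∎
    where open ≡-Reasoning
  length-subsets (outside ∷ p) = trans (length-map (outside ∷_) (subsets p)) (length-subsets p)

  ∈-subsets⁺ : q ⊆ p → q ∈ₗ subsets p
  ∈-subsets⁺ {q = []}          {p = []}          _   = here refl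
  ∈-subsets⁺ {q = inside  ∷ q} {p = inside  ∷ p} q⊆p = ∈-++⁺ˡ (∈-map⁺ (inside ∷_) (∈-subsets⁺ (drop-∷-⊆ q⊆p)))
  ∈-subsets⁺ {q = outside ∷ q} {p = inside  ∷ p} q⊆p = ∈-++⁺ʳ _ (∈-map⁺ (outside ∷_) (∈-subsets⁺ (drop-∷-⊆ q⊆p)))
  ∈-subsets⁺ {q = inside  ∷ q} {p = outside ∷ p} q⊆p with q⊆p here
  ... | ()
  ∈-subsets⁺ {q = outside ∷ q} {p = outside ∷ p} q⊆p = ∈-map⁺ (outside ∷_) (∈-subsets⁺ (drop-∷-⊆ q⊆p))

  length-cartesianProduct : ∀ {A B : Set} (xs : List A) (ys : List B) →
    length (cartesianProduct xs ys) ≡ length xs * length ys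
  length-cartesianProduct []       ys = refl
  length-cartesianProduct (x ∷ xs) ys = begin
    length (map (x ,_) ys ++ cartesianProduct xs ys)
      ≡⟨ length-++ (map (x ,_) ys) ⟩
    length (map (x ,_) ys) + length (cartesianProduct xs ys)
      ≡⟨ cong₂ _+_ (length-map (x ,_) ys) (length-cartesianProduct xs ys) ⟩
    length ys + length xs * length ys
      ∎
    where open ≡-Reasoning

module Ramsey {I : Set} (is : List I) where

  open Subsets
  open import Data.Bool using (Bool)
  open import Data.Fin as Fin using (Fin)
  import Data.Fin.Properties as Fin
  open import Data.Fin.Subset
  open import Data.Fin.Subset.Properties
  open import Data.List using (length; cartesianProduct)
  open import Data.List.Membership.Propositional using () renaming (_∈_ to _∈ₗ_)
  open import Data.List.Membership.Propositional.Properties using (∈-cartesianProduct⁺)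
  open import Data.Nat using (ℕ; zero; suc; _+_; _*_; _^_; _≤_; s≤s; z≤n)
  open import Data.Nat.Properties
    using ( +-suc; +-identityʳ; <⇒≤; ≤-refl; *-cancelˡ-≤; m^n≢0; ≤-trans; ≤-reflexive; ≤-pred
          ; suc-injective; <-≤-trans)
  open import Data.Product using (∃; _×_; _,_)
  open import Data.Sum using (inj₁; inj₂)
  open import Function using (_∘_)
  open import Relation.Nullary using (contradiction)
  open import Relation.Binary.PropositionalEquality hiding ([_])

  -- One candidate has to survive the construction: it witnesses end-homogeneity.
  endHomogeneousBound : ℕ → ℕ → ℕ
  endHomogeneousBound zero    p = 1
  endHomogeneousBound (suc k) p = 2 ^ (2 ^ p * length is) * suc (endHomogeneousBound k (suc p))

  ramseyBound : ℕ → ℕ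
  ramseyBound zero    = 0
  ramseyBound (suc n) = endHomogeneousBound (suc (ramseyBound n)) 0

  module _ {N : ℕ} where

    _≺_ : Subset N → Fin N → Set
    U ≺ x = ∀ {u} → u ∈ U → u Fin.< x

    Colouring : Set
    Colouring = Subset N → I → Bool

    _≈_ : (I → Bool) → (I → Bool) → Set
    c ≈ c′ = ∀ {i} → i ∈ₗ is → c i ≡ c′ i

    ≈-reflexive : ∀ {c c′} → c ≡ c′ → c ≈ c′
    ≈-reflexive refl _ = refl

    ≈-sym : ∀ {c c′} → c ≈ c′ → c′ ≈ c
    ≈-sym c≈c′ i∈is = sym (c≈c′ i∈is)

    ≈-trans : ∀ {c c′ c″} → c ≈ c′ → c′ ≈ c″ → c ≈ c″
    ≈-trans c≈c′ c′≈c″ i∈is = trans (c≈c′ i∈is) (c′≈c″ i∈is)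

    Homogeneous : Colouring → Subset N → Set
    Homogeneous χ S = ∀ {T₁ T₂} → T₁ ⊆ S → T₂ ⊆ S → ∣ T₁ ∣ ≡ ∣ T₂ ∣ → χ T₁ ≈ χ T₂

    EndHomogeneous : Colouring → Subset N → Set
    EndHomogeneous χ E = ∀ {U x y} → U ⊆ E → x ∈ E → y ∈ E → U ≺ x → U ≺ y → χ (U ∪ ⁅ x ⁆) ≈ χ (U ∪ ⁅ y ⁆)

    record Candidates (χ : Colouring) (P A : Subset N) : Set where
      field
        above : ∀ {z} → z ∈ A → P ≺ z
        agree : ∀ {U x y} → U ⊆ P → x ∈ P → y ∈ A → U ≺ x → χ (U ∪ ⁅ x ⁆) ≈ χ (U ∪ ⁅ y ⁆)

    candidates-⊥ : ∀ {χ A} → Candidates χ ⊥ A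
    candidates-⊥ = record { above = λ _ u∈⊥ → contradiction u∈⊥ ∉⊥ ; agree = λ _ x∈⊥ → contradiction x∈⊥ ∉⊥ }

    candidates⇒endHomogeneous : ∀ {χ P A} → Candidates χ P A → Nonempty A → EndHomogeneous χ P
    candidates⇒endHomogeneous cands (z , z∈A) U⊆P x∈P y∈P U≺x U≺y i∈is =
      trans (agree U⊆P x∈P z∈A U≺x i∈is) (sym (agree U⊆P y∈P z∈A U≺y i∈is))
      where open Candidates cands

    extensionColour : Colouring → Subset N × I → Fin N → Bool
    extensionColour χ (U , i) x = χ (U ∪ ⁅ x ⁆) i

    keys : Subset N → List (Subset N × I)
    keys P = cartesianProduct (subsets P) is

    length-keys : ∀ P → length (keys P) ≡ 2 ^ ∣ P ∣ * length is
    length-keys P = trans (length-cartesianProduct (subsets P) is) (cong (_* length is) (length-subsets P))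

    candidates-∪⁅min⁆ : ∀ {χ P A B a} → Candidates χ P A → B ⊆ A →
             (∀ {κ} → κ ∈ₗ keys P → ConstantOn (extensionColour χ κ) B) →
             a ∈ B → (∀ {y} → y ∈ B → a Fin.≤ y) → Candidates χ (P ∪ ⁅ a ⁆) (B - a)
    candidates-∪⁅min⁆ {χ} {P} {A} {B} {a} cands B⊆A constant a∈B a≤ = record { above = above′ ; agree = agree′ }
      where
      open Candidates cands
      y∈B-a⇒y∈B : ∀ {y} → y ∈ B - a → y ∈ B
      y∈B-a⇒y∈B = p─q⊆p B ⁅ a ⁆
      ≤a : ∀ {x} → x ∈ P ∪ ⁅ a ⁆ → x Fin.≤ a
      ≤a x∈P∪a with x∈p∪⁅y⁆⁻ x∈P∪a
      ... | inj₁ x∈P  = <⇒≤ (above (B⊆A a∈B) x∈P)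
      ... | inj₂ refl = ≤-refl
      ⊆P : ∀ {U x} → U ⊆ P ∪ ⁅ a ⁆ → x ∈ P ∪ ⁅ a ⁆ → U ≺ x → U ⊆ P
      ⊆P U⊆P∪a x∈P∪a U≺x u∈U with x∈p∪⁅y⁆⁻ (U⊆P∪a u∈U)
      ... | inj₁ u∈P  = u∈P
      ... | inj₂ refl = contradiction (<-≤-trans (U≺x u∈U) (≤a x∈P∪a)) (Fin.<-irrefl refl)
      above′ : ∀ {z} → z ∈ B - a → (P ∪ ⁅ a ⁆) ≺ z
      above′ z∈B-a u∈P∪a with x∈p∪⁅y⁆⁻ u∈P∪a
      ... | inj₁ u∈P  = above (B⊆A (y∈B-a⇒y∈B z∈B-a)) u∈P
      ... | inj₂ refl = Fin.≤∧≢⇒< (a≤ (y∈B-a⇒y∈B z∈B-a)) (λ a≡z → x∈p-y⇒x≢y z∈B-a (sym a≡z))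
      agree′ : ∀ {U x y} → U ⊆ P ∪ ⁅ a ⁆ → x ∈ P ∪ ⁅ a ⁆ → y ∈ B - a → U ≺ x → χ (U ∪ ⁅ x ⁆) ≈ χ (U ∪ ⁅ y ⁆)
      agree′ U⊆P∪a x∈P∪a y∈B-a U≺x i∈is with x∈p∪⁅y⁆⁻ x∈P∪a
      ... | inj₁ x∈P  = agree (⊆P U⊆P∪a x∈P∪a U≺x) x∈P (B⊆A (y∈B-a⇒y∈B y∈B-a)) U≺x i∈is
      ... | inj₂ refl =
        constant (∈-cartesianProduct⁺ (∈-subsets⁺ (⊆P U⊆P∪a x∈P∪a U≺x)) i∈is) a∈B (y∈B-a⇒y∈B y∈B-a)

    uniformCandidates : ∀ k χ P A → endHomogeneousBound (suc k) ∣ P ∣ ≤ ∣ A ∣ →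
      ∃ λ B → B ⊆ A × suc (endHomogeneousBound k (suc ∣ P ∣)) ≤ ∣ B ∣ ×
              (∀ {κ} → κ ∈ₗ keys P → ConstantOn (extensionColour χ κ) B)
    uniformCandidates k χ P A bound with uniformise (extensionColour χ) (keys P) A
    ... | B , B⊆A , ∣A∣≤ , constant = B , B⊆A , *-cancelˡ-≤ (2 ^ L) {{m^n≢0 2 L}} 2^L*[1+bound]≤2^L*∣B∣ , constant
      where
      L = 2 ^ ∣ P ∣ * length is
      2^L*[1+bound]≤2^L*∣B∣ = ≤-trans bound (subst (λ l → ∣ A ∣ ≤ 2 ^ l * ∣ B ∣) (length-keys P) ∣A∣≤)

    extendToEndHomogeneous : ∀ k χ {P A} → Candidates χ P A → endHomogeneousBound k ∣ P ∣ ≤ ∣ A ∣ →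
                     ∃ λ E → E ⊆ P ∪ A × ∣ E ∣ ≡ ∣ P ∣ + k × EndHomogeneous χ E
    extendToEndHomogeneous zero χ {P} {A} cands bound =
      P , p⊆p∪q A , sym (+-identityʳ ∣ P ∣) , candidates⇒endHomogeneous cands (1≤∣p∣⇒Nonempty bound)
    extendToEndHomogeneous (suc k) χ {P} {A} cands bound with uniformCandidates k χ P A bound
    ... | B , B⊆A , 1+bound≤∣B∣ , constant with minimum (1≤∣p∣⇒Nonempty (≤-trans (s≤s z≤n) 1+bound≤∣B∣))
    ...   | a , a∈B , a≤ =
      addMinimum (extendToEndHomogeneous k χ (candidates-∪⁅min⁆ cands B⊆A constant a∈B a≤) bound′)
      where
      ∣P∪a∣≡ : ∣ P ∪ ⁅ a ⁆ ∣ ≡ suc ∣ P ∣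
      ∣P∪a∣≡ = x∉p⇒∣p∪⁅x⁆∣≡1+∣p∣ (λ a∈P → Fin.<-irrefl refl (Candidates.above cands (B⊆A a∈B) a∈P))
      bound′ : endHomogeneousBound k ∣ P ∪ ⁅ a ⁆ ∣ ≤ ∣ B - a ∣
      bound′ rewrite ∣P∪a∣≡ = ≤-pred (subst (_ ≤_) (x∈p⇒∣p∣≡1+∣p-x∣ a∈B) 1+bound≤∣B∣)
      P∪a∪B-a⊆P∪A : (P ∪ ⁅ a ⁆) ∪ (B - a) ⊆ P ∪ A
      P∪a∪B-a⊆P∪A = ∪-lub (∪-lub (p⊆p∪q A) (x∈p⇒⁅x⁆⊆p (q⊆p∪q P A (B⊆A a∈B)))) (q⊆p∪q P A ∘ B⊆A ∘ p─q⊆p B _)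
      addMinimum : (∃ λ E → E ⊆ (P ∪ ⁅ a ⁆) ∪ (B - a) × ∣ E ∣ ≡ ∣ P ∪ ⁅ a ⁆ ∣ + k × EndHomogeneous χ E) →
                   ∃ λ E → E ⊆ P ∪ A × ∣ E ∣ ≡ ∣ P ∣ + suc k × EndHomogeneous χ E
      addMinimum (E , E⊆ , ∣E∣≡ , endHom) =
        E , P∪a∪B-a⊆P∪A ∘ E⊆ , trans ∣E∣≡ (trans (cong (_+ k) ∣P∪a∣≡) (sym (+-suc ∣ P ∣ k))) , endHom

    endHomogeneousWithin : ∀ m χ A → endHomogeneousBound m 0 ≤ ∣ A ∣ →
                           ∃ λ E → E ⊆ A × ∣ E ∣ ≡ m × EndHomogeneous χ E
    endHomogeneousWithin m χ A bound
      with extendToEndHomogeneous m χ {⊥} (candidates-⊥ {χ})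
             (subst (λ p → endHomogeneousBound m p ≤ ∣ A ∣) (sym (∣⊥∣≡0 N)) bound)
    ... | E , E⊆⊥∪A , ∣E∣≡ , endHom =
      E , subst (_ ⊆_) (∪-identityˡ A) E⊆⊥∪A , trans ∣E∣≡ (cong (_+ m) (∣⊥∣≡0 N)) , endHom

    module _ {χ : Colouring} {E : Subset N} (endHom : EndHomogeneous χ E)
             {a : Fin N} (a∈E : a ∈ E) (≤a : ∀ {y} → y ∈ E → y Fin.≤ a)
             {S′ : Subset N} (S′⊆E-a : S′ ⊆ E - a) where

      S′∪a⊆E : S′ ∪ ⁅ a ⁆ ⊆ E
      S′∪a⊆E = x∈q∧p⊆q-x⇒p∪⁅x⁆⊆q a∈E S′⊆E-a

      dropMaximum : ∀ {T} → T ⊆ S′ ∪ ⁅ a ⁆ → Nonempty T →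
                    ∃ λ U → U ⊆ S′ × ∣ T ∣ ≡ suc ∣ U ∣ × χ T ≈ χ (U ∪ ⁅ a ⁆)
      dropMaximum {T} T⊆S ne with maximum ne
      ... | m , m∈T , ≤m = T - m , U⊆S′ , x∈p⇒∣p∣≡1+∣p-x∣ m∈T , χT≈χ[U∪a]
        where
        U≺m : (T - m) ≺ m
        U≺m u∈U = Fin.≤∧≢⇒< (≤m (p─q⊆p T _ u∈U)) (x∈p-y⇒x≢y u∈U)
        U≺a : (T - m) ≺ a
        U≺a u∈U = <-≤-trans (U≺m u∈U) (≤a (S′∪a⊆E (T⊆S m∈T)))
        U⊆S′ : T - m ⊆ S′
        U⊆S′ u∈U with x∈p∪⁅y⁆⁻ (T⊆S (p─q⊆p T _ u∈U))
        ... | inj₁ u∈S′ = u∈S′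
        ... | inj₂ refl = contradiction (U≺a u∈U) (Fin.<-irrefl refl)
        χT≈χ[U∪a] : χ T ≈ χ ((T - m) ∪ ⁅ a ⁆)
        χT≈χ[U∪a] = ≈-trans (≈-reflexive (cong χ (sym (x∈p⇒p-x∪⁅x⁆≡p m∈T))))
          (endHom (S′∪a⊆E ∘ T⊆S ∘ p─q⊆p T _) (S′∪a⊆E (T⊆S m∈T)) a∈E U≺m U≺a)

      homogeneous-∪⁅max⁆ : Homogeneous (λ U → χ (U ∪ ⁅ a ⁆)) S′ → Homogeneous χ (S′ ∪ ⁅ a ⁆)
      homogeneous-∪⁅max⁆ hom {T₁} {T₂} T₁⊆S T₂⊆S ∣T₁∣≡∣T₂∣ with ∣ T₁ ∣ in ∣T₁∣≡
      ... | zero  = ≈-reflexive (cong χ (trans (∣p∣≡0⇒p≡⊥ ∣T₁∣≡) (sym (∣p∣≡0⇒p≡⊥ (sym ∣T₁∣≡∣T₂∣)))))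
      ... | suc _ with dropMaximum T₁⊆S (1≤∣p∣⇒Nonempty (subst (1 ≤_) (sym ∣T₁∣≡) (s≤s z≤n)))
                     | dropMaximum T₂⊆S (1≤∣p∣⇒Nonempty (subst (1 ≤_) ∣T₁∣≡∣T₂∣ (s≤s z≤n)))
      ...   | U₁ , U₁⊆S′ , ∣T₁∣≡1+∣U₁∣ , χT₁≈ | U₂ , U₂⊆S′ , ∣T₂∣≡1+∣U₂∣ , χT₂≈ =
        ≈-trans χT₁≈ (≈-trans (hom U₁⊆S′ U₂⊆S′ ∣U₁∣≡∣U₂∣) (≈-sym χT₂≈))
        where
        ∣U₁∣≡∣U₂∣ = suc-injective (trans (sym ∣T₁∣≡1+∣U₁∣) (trans ∣T₁∣≡ (trans ∣T₁∣≡∣T₂∣ ∣T₂∣≡1+∣U₂∣)))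

    ramsey : ∀ n χ A → ramseyBound n ≤ ∣ A ∣ → ∃ λ S → S ⊆ A × ∣ S ∣ ≡ n × Homogeneous χ S
    ramsey zero χ A _ = ⊥ , ⊥⊆ , ∣⊥∣≡0 N ,
      λ T₁⊆⊥ T₂⊆⊥ _ → ≈-reflexive (cong χ (trans (⊆-antisym T₁⊆⊥ ⊥⊆) (sym (⊆-antisym T₂⊆⊥ ⊥⊆))))
    ramsey (suc n) χ A bound with endHomogeneousWithin (suc (ramseyBound n)) χ A bound
    ... | E , E⊆A , ∣E∣≡ , endHom with maximum (1≤∣p∣⇒Nonempty (subst (1 ≤_) (sym ∣E∣≡) (s≤s z≤n)))
    ...   | a , a∈E , ≤a = addMaximum (ramsey n (λ U → χ (U ∪ ⁅ a ⁆)) (E - a) bound′)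
      where
      bound′ : ramseyBound n ≤ ∣ E - a ∣
      bound′ = ≤-reflexive (suc-injective (trans (sym ∣E∣≡) (x∈p⇒∣p∣≡1+∣p-x∣ a∈E)))
      addMaximum : (∃ λ S′ → S′ ⊆ E - a × ∣ S′ ∣ ≡ n × Homogeneous (λ U → χ (U ∪ ⁅ a ⁆)) S′) →
                   ∃ λ S → S ⊆ A × ∣ S ∣ ≡ suc n × Homogeneous χ S
      addMaximum (S′ , S′⊆E-a , ∣S′∣≡n , hom) =
        S′ ∪ ⁅ a ⁆ , E⊆A ∘ x∈q∧p⊆q-x⇒p∪⁅x⁆⊆q a∈E S′⊆E-a ,
        trans (x∉p⇒∣p∪⁅x⁆∣≡1+∣p∣ (x∉p-x {p = E} ∘ S′⊆E-a)) (cong suc ∣S′∣≡n) ,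
        homogeneous-∪⁅max⁆ endHom a∈E ≤a S′⊆E-a hom

module Thresholds where

  open import Data.Nat as ℕ using (ℕ; zero; suc)
  import Data.Nat.Properties as ℕ
  open import Data.Integer as ℤ using (+_; +[1+_]; -[1+_]; +≤+)
  import Data.Integer.Properties as ℤ
  open import Data.Integer.Tactic.RingSolver using (solve-∀)
  open import Data.Rational
  open import Data.Rational.Properties
  open import Data.Rational.Unnormalised as ℚᵘ using (mkℚᵘ; *≡*; *≤*)
  import Data.Rational.Unnormalised.Properties as ℚᵘ
  open import Algebra.Definitions.RawMonoid +-0-rawMonoid public using () renaming (_×_ to _·_)
  open import Algebra.Properties.AbelianGroup +-0-abelianGroup using (⁻¹-anti-homo‿-; xyx⁻¹≈y)
  open import Data.Product using (∃; _,_)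
  open import Data.Sum using (_⊎_; inj₁; inj₂)
  open import Relation.Nullary using (¬_; does; yes; no; contradiction)
  open import Relation.Nullary.Decidable using (dec-true; dec-false)
  open import Relation.Binary.PropositionalEquality

  toℚᵘ-· : ∀ m ε → toℚᵘ (m · ε) ℚᵘ.≃ mkℚᵘ (+ m ℤ.* ↥ ε) (ℚ.denominator-1 ε)
  toℚᵘ-· zero    ε@record{} = *≡* (trans (ℤ.*-zeroˡ (↧ ε)) (sym (ℤ.*-zeroˡ (+ 1))))
  toℚᵘ-· (suc m) ε@record{} = ℚᵘ.≃-trans (toℚᵘ-homo-+ ε (m · ε))
    (ℚᵘ.≃-trans (ℚᵘ.+-congʳ (toℚᵘ ε) (toℚᵘ-· m ε)) (*≡* (begin
      (a ℤ.* D ℤ.+ + m ℤ.* a ℤ.* D) ℤ.* D  ≡⟨ distribute (+ m) a D ⟩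
      + suc m ℤ.* a ℤ.* (D ℤ.* D)          ≡⟨ cong (+ suc m ℤ.* a ℤ.*_) (ℤ.pos-* (suc d) (suc d)) ⟨
      + suc m ℤ.* a ℤ.* + (suc d ℕ.* suc d)  ∎)))
    where
    open ≡-Reasoning
    a = ↥ ε
    d = ℚ.denominator-1 ε
    D = + suc d
    distribute : ∀ x y z → (y ℤ.* z ℤ.+ x ℤ.* y ℤ.* z) ℤ.* z ≡ (+ 1 ℤ.+ x) ℤ.* y ℤ.* (z ℤ.* z)
    distribute = solve-∀

  -- K = denominator of ε works: K · ε is then the numerator of ε.
  archimedean : ∀ {ε} → 0ℚ < ε → ∃ λ K → 1ℚ ≤ K · ε
  archimedean {ε@(mkℚ +[1+ k ] d _)} _ = suc d , toℚᵘ-cancel-≤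
    (ℚᵘ.≤-respʳ-≃ (ℚᵘ.≃-sym (toℚᵘ-· (suc d) ε)) (*≤* (subst₂ ℤ._≤_
      (sym (ℤ.*-identityˡ (+ suc d)))
      (trans (ℤ.pos-* (suc d) (suc k)) (sym (ℤ.*-identityʳ _)))
      (+≤+ (ℕ.m≤m*n (suc d) (suc k))))))
  archimedean {mkℚ (+ 0)    _ _} (*<* (ℤ.+<+ ()))
  archimedean {mkℚ -[1+ _ ] _ _} (*<* ())

  p≤q+r⇒p-q≤r : ∀ {p q r} → p ≤ q + r → p - q ≤ r
  p≤q+r⇒p-q≤r {q = q} {r} p≤q+r = ≤-trans (+-monoˡ-≤ (- q) p≤q+r) (≤-reflexive (xyx⁻¹≈y q r))

  ∣p-q∣≤r : ∀ {p q r} → p ≤ q + r → q ≤ p + r → ∣ p - q ∣ ≤ r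
  ∣p-q∣≤r {p} {q} {r} p≤q+r q≤p+r with ∣p∣≡p∨∣p∣≡-p (p - q)
  ... | inj₁ ∣p-q∣≡p-q = subst (_≤ r) (sym ∣p-q∣≡p-q) (p≤q+r⇒p-q≤r p≤q+r)
  ... | inj₂ ∣p-q∣≡q-p = subst (_≤ r) (sym (trans ∣p-q∣≡q-p (⁻¹-anti-homo‿- p q))) (p≤q+r⇒p-q≤r q≤p+r)

  SameThresholds : ℚ → ℕ → ℚ → ℚ → Set
  SameThresholds ε K v w = ∀ m → m ℕ.≤ K → does (m · ε ≤? v) ≡ does (m · ε ≤? w)

  module _ {ε : ℚ} (0≤ε : 0ℚ ≤ ε) {K : ℕ} (1≤K·ε : 1ℚ ≤ K · ε) where

    sameThresholds⇒≤+ε : ∀ {v w} → v ≤ 1ℚ → 0ℚ ≤ w → SameThresholds ε K v w → v ≤ w + ε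
    sameThresholds⇒≤+ε {v} {w} v≤1 0≤w same with belowOrClose K ℕ.≤-refl
      where
      -- The first threshold above w is, by assumption, also above v.
      belowOrClose : ∀ m → m ℕ.≤ K → m · ε ≤ w ⊎ v ≤ w + ε
      belowOrClose zero    _   = inj₁ 0≤w
      belowOrClose (suc m) m<K with belowOrClose m (ℕ.<⇒≤ m<K)
      ... | inj₂ v≤w+ε = inj₂ v≤w+ε
      ... | inj₁ m·ε≤w with suc m · ε ≤? w
      ...   | yes 1+m·ε≤w = inj₁ 1+m·ε≤w
      ...   | no  1+m·ε≰w = inj₂ (<⇒≤ (begin-strict
        v          <⟨ ≰⇒> 1+m·ε≰v ⟩
        ε + m · ε  ≤⟨ +-monoʳ-≤ ε m·ε≤w ⟩
        ε + w      ≡⟨ +-comm ε w ⟩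
        w + ε      ∎))
        where
        open ≤-Reasoning
        1+m·ε≰v : ¬ (suc m · ε ≤ v)
        1+m·ε≰v 1+m·ε≤v = contradiction
          (trans (sym (dec-true (_ ≤? v) 1+m·ε≤v)) (trans (same (suc m) m<K) (dec-false (_ ≤? w) 1+m·ε≰w)))
          λ ()
    ... | inj₂ v≤w+ε = v≤w+ε
    ... | inj₁ K·ε≤w = begin
      v       ≤⟨ v≤1 ⟩
      1ℚ      ≤⟨ 1≤K·ε ⟩
      K · ε   ≤⟨ K·ε≤w ⟩
      w       ≡⟨ +-identityʳ w ⟨
      w + 0ℚ  ≤⟨ +-monoʳ-≤ w 0≤ε ⟩
      w + ε   ∎
      where open ≤-Reasoning

    sameThresholds⇒∣-∣≤ε : ∀ {v w} → 0ℚ ≤ v → v ≤ 1ℚ → 0ℚ ≤ w → w ≤ 1ℚ →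
                           SameThresholds ε K v w → ∣ v - w ∣ ≤ ε
    sameThresholds⇒∣-∣≤ε 0≤v v≤1 0≤w w≤1 same = ∣p-q∣≤r
      (sameThresholds⇒≤+ε v≤1 0≤w same)
      (sameThresholds⇒≤+ε w≤1 0≤v (λ m m≤K → sym (same m m≤K)))

module ThresholdColouring where

  open import Defs
  open Subsets using (∈-tabulate⁻; ∈-tabulate⁺)
  open Thresholds
  open import Data.Bool using (Bool; false)
  open import Data.Fin as Fin using (Fin)
  import Data.Fin.Properties as Fin
  open import Data.Fin.Subset using (Subset; _∈_; _∉_; _⊆_; _∩_; ∣_∣)
  open import Data.Fin.Subset.Properties using (_∈?_; x∈p∩q⁺; x∈p∩q⁻; p⊂q⇒∣p∣<∣q∣; p⊆q⇒∣p∣≤∣q∣)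
  open import Data.List using (upTo; cartesianProduct)
  open import Data.List.Membership.Propositional.Properties using (∈-cartesianProduct⁺; ∈-upTo⁺)
  open import Data.Nat as ℕ using (ℕ; suc; _≤_; s≤s)
  import Data.Nat.Properties as ℕ
  open import Data.Product using (_×_; _,_; proj₁; proj₂)
  open import Data.Rational as ℚ using (ℚ; 0ℚ; 1ℚ; _-_)
  open import Data.Vec.Properties.WithK using ([]=-irrelevant)
  open import Relation.Binary using (tri<; tri≈; tri>)
  open import Relation.Nullary using (Dec; yes; no; does; contradiction)
  open import Relation.Nullary.Decidable using (_×-dec_; toWitness; fromWitness)
  open import Relation.Binary.PropositionalEquality

  private
    variable
      N i : ℕ
      T : Subset N
      t t′ x : Fin N

  ∈-StrictlyAbove⁻ : x ∈ StrictlyAbove t → t Fin.< x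
  ∈-StrictlyAbove⁻ x∈ = toWitness (∈-tabulate⁻ x∈)

  ∈-StrictlyAbove⁺ : t Fin.< x → x ∈ StrictlyAbove t
  ∈-StrictlyAbove⁺ t<x = ∈-tabulate⁺ (fromWitness t<x)

  t<t′⇒∣T∩above-t′∣<∣T∩above-t∣ : t Fin.< t′ → t′ ∈ T →
                                   ∣ T ∩ StrictlyAbove t′ ∣ ℕ.< ∣ T ∩ StrictlyAbove t ∣
  t<t′⇒∣T∩above-t′∣<∣T∩above-t∣ {t = t} {t′} {T = T} t<t′ t′∈T =
    p⊂q⇒∣p∣<∣q∣ (above-t′⊆above-t , t′ , x∈p∩q⁺ (t′∈T , ∈-StrictlyAbove⁺ t<t′) , t′∉above-t′)
    where
    above-t′⊆above-t : T ∩ StrictlyAbove t′ ⊆ T ∩ StrictlyAbove t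
    above-t′⊆above-t x∈ with x∈p∩q⁻ T _ x∈
    ... | x∈T , x∈above-t′ = x∈p∩q⁺ (x∈T , ∈-StrictlyAbove⁺ (Fin.<-trans t<t′ (∈-StrictlyAbove⁻ x∈above-t′)))
    t′∉above-t′ : t′ ∉ T ∩ StrictlyAbove t′
    t′∉above-t′ t′∈ = Fin.<-irrefl refl (∈-StrictlyAbove⁻ (proj₂ (x∈p∩q⁻ T _ t′∈)))

  IsIthLargest-unique : IsIthLargest T i t → IsIthLargest T i t′ → t ≡ t′
  IsIthLargest-unique {t = t} {t′} (t∈T , rank-t) (t′∈T , rank-t′) with Fin.<-cmp t t′
  ... | tri≈ _ t≡t′ _ = t≡t′
  ... | tri< t<t′ _ _ =
    contradiction (ℕ.suc-injective (trans rank-t′ (sym rank-t))) (ℕ.<⇒≢ (t<t′⇒∣T∩above-t′∣<∣T∩above-t∣ t<t′ t′∈T))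
  ... | tri> _ _ t′<t =
    contradiction (ℕ.suc-injective (trans rank-t (sym rank-t′))) (ℕ.<⇒≢ (t<t′⇒∣T∩above-t′∣<∣T∩above-t∣ t′<t t∈T))

  isIthLargest? : ∀ (T : Subset N) i t → Dec (IsIthLargest T i t)
  isIthLargest? T i t = (t ∈? T) ×-dec (suc ∣ T ∩ StrictlyAbove t ∣ ℕ.≟ i)

  module _ (ε : ℚ) {N} (f : (t : Fin N) (T : Subset N) → t ∈ T → ℚ) where

    thresholdColouring : Subset N → ℕ × ℕ → Bool
    thresholdColouring T (i , m) with Fin.any? (isIthLargest? T i)
    ... | yes (t , t∈T , _) = does (m · ε ℚ.≤? f t T t∈T)
    ... | no _              = false

    thresholdColouring-ith : ∀ {T i t m} (h : IsIthLargest T i t) →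
                             thresholdColouring T (i , m) ≡ does (m · ε ℚ.≤? f t T (proj₁ h))
    thresholdColouring-ith {T} {i} {t} {m} h with Fin.any? (isIthLargest? T i)
    ... | no ∄ = contradiction (t , h) ∄
    ... | yes (t′ , h′) with IsIthLargest-unique h′ h
    ...   | refl = cong (λ t∈T → does (m · ε ℚ.≤? f t T t∈T)) ([]=-irrelevant (proj₁ h′) (proj₁ h))

  thresholdIndices : ℕ → ℕ → List (ℕ × ℕ)
  thresholdIndices n K = cartesianProduct (upTo (suc n)) (upTo (suc K))

  thresholdHomogeneous⇒close : ∀ {ε K n N} → 0ℚ ℚ.≤ ε → 1ℚ ℚ.≤ K · ε →
    (f : (t : Fin N) (T : Subset N) → t ∈ T → ℚ) →
    ((t : Fin N) (T : Subset N) (p : t ∈ T) → (0ℚ ℚ.≤ f t T p) × (f t T p ℚ.≤ 1ℚ)) →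
    ∀ {S T₁ T₂ i t₁ t₂} → ∣ S ∣ ≡ n → Ramsey.Homogeneous (thresholdIndices n K) (thresholdColouring ε f) S →
    T₁ ⊆ S → T₂ ⊆ S → ∣ T₁ ∣ ≡ ∣ T₂ ∣ → i ≤ ∣ T₁ ∣ →
    (h₁ : IsIthLargest T₁ i t₁) (h₂ : IsIthLargest T₂ i t₂) →
    ℚ.∣ f t₁ T₁ (proj₁ h₁) - f t₂ T₂ (proj₁ h₂) ∣ ℚ.≤ ε
  thresholdHomogeneous⇒close {ε} {K} {n} 0≤ε 1≤K·ε f f∈[0,1] {S} {T₁} {T₂} {i} {t₁} {t₂}
                    ∣S∣≡n homogeneous T₁⊆S T₂⊆S ∣T₁∣≡∣T₂∣ i≤∣T₁∣ h₁ h₂ =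
    sameThresholds⇒∣-∣≤ε 0≤ε 1≤K·ε (proj₁ (f∈[0,1] t₁ T₁ (proj₁ h₁))) (proj₂ (f∈[0,1] t₁ T₁ (proj₁ h₁)))
                                    (proj₁ (f∈[0,1] t₂ T₂ (proj₁ h₂))) (proj₂ (f∈[0,1] t₂ T₂ (proj₁ h₂)))
                                    sameThresholds
    where
    i≤n : i ≤ n
    i≤n = ℕ.≤-trans i≤∣T₁∣ (ℕ.≤-trans (p⊆q⇒∣p∣≤∣q∣ T₁⊆S) (ℕ.≤-reflexive ∣S∣≡n))
    sameThresholds : SameThresholds ε K (f t₁ T₁ (proj₁ h₁)) (f t₂ T₂ (proj₁ h₂))
    sameThresholds m m≤K = begin
      does (m · ε ℚ.≤? f t₁ T₁ (proj₁ h₁))  ≡⟨ thresholdColouring-ith ε f h₁ ⟨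
      thresholdColouring ε f T₁ (i , m)     ≡⟨ homogeneous T₁⊆S T₂⊆S ∣T₁∣≡∣T₂∣ index∈indices ⟩
      thresholdColouring ε f T₂ (i , m)     ≡⟨ thresholdColouring-ith ε f h₂ ⟩
      does (m · ε ℚ.≤? f t₂ T₂ (proj₁ h₂))  ∎
      where
      open ≡-Reasoning
      index∈indices = ∈-cartesianProduct⁺ (∈-upTo⁺ (s≤s i≤n)) (∈-upTo⁺ (s≤s m≤K))

open import Defs
open import Data.Nat using (ℕ; _≤_)
open import Data.Fin using (Fin)
open import Data.Fin.Subset using (Subset; _∈_; _⊆_; ∣_∣; ⊤)
open import Data.Fin.Subset.Properties using (∣⊤∣≡n)
open import Data.Rational using (ℚ; 0ℚ; 1ℚ; _<_; _-_; ∣_∣)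
open import Data.Rational.Properties using (<⇒≤)
open import Data.Nat.Properties using (≤-reflexive)
open import Data.Product using (Σ; ∃; _×_; _,_; proj₁)
open import Relation.Binary.PropositionalEquality using (_≡_; sym)
import Data.Rational as Q
open Thresholds using (archimedean)
open ThresholdColouring using (thresholdColouring; thresholdIndices; thresholdHomogeneous⇒close)

lemma7 : (ε : ℚ) → 0ℚ < ε → (n : ℕ) →
    ∃ λ (N : ℕ) →
      (f : (t : Fin N) → (T : Subset N) → t ∈ T → ℚ) →
      ((t : Fin N) (T : Subset N) (p : t ∈ T) → (0ℚ Q.≤ f t T p) × (f t T p Q.≤ 1ℚ)) →
      Σ (Subset N) λ S →
        (Data.Fin.Subset.∣ S ∣ ≡ n) ×
        ((T₁ T₂ : Subset N) → T₁ ⊆ S → T₂ ⊆ S →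
          Data.Fin.Subset.∣ T₁ ∣ ≡ Data.Fin.Subset.∣ T₂ ∣ → 1 ≤ Data.Fin.Subset.∣ T₁ ∣ →
          (i : ℕ) → 1 ≤ i → i ≤ Data.Fin.Subset.∣ T₁ ∣ →
          (t₁ t₂ : Fin N) (h₁ : IsIthLargest T₁ i t₁) (h₂ : IsIthLargest T₂ i t₂) →
          Data.Rational.∣ f t₁ T₁ (proj₁ h₁) - f t₂ T₂ (proj₁ h₂) ∣ Q.≤ ε)
lemma7 ε 0<ε n with archimedean 0<ε
... | K , 1≤K·ε = ramseyBound n , λ f f∈[0,1] →
  let S , _ , ∣S∣≡n , homogeneous = ramsey n (thresholdColouring ε f) ⊤ (≤-reflexive (sym (∣⊤∣≡n _)))
  in S , ∣S∣≡n , λ T₁ T₂ T₁⊆S T₂⊆S ∣T₁∣≡∣T₂∣ _ _ _ i≤∣T₁∣ _ _ →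
       thresholdHomogeneous⇒close (<⇒≤ 0<ε) 1≤K·ε f f∈[0,1] ∣S∣≡n homogeneous T₁⊆S T₂⊆S ∣T₁∣≡∣T₂∣ i≤∣T₁∣
  where
  open Ramsey (thresholdIndices n K)
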